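{- For any $r$-regular graph $G$ with $r\ge 1$, $\mathcal{M}_{1-\lceil r/2\rceil}(G)=\gamma_t(G)$.
   Context: All graphs are finite and simple. For a vertex $v$, $\delta(v)$ is its degree and $\delta_X(v)=|N(v)\cap X|$ the number of its neighbors in $X$. For an integer $k$ with $1-\lceil\delta(G)/2\rceil\le k\le\lfloor\delta(G)/2\rfloor$ (where $\delta(G)$ is the minimum degree), a nonempty set $M\subseteq V(G)$ is a $k$-monopoly if every vertex $v$ satisfies $\delta_M(v)\ge\frac{\delta(v)}{2}+k$; $\mathcal{M}_k(G)$ is the minimum cardinality of a $k$-monopoly. A set $D$ is a total dominating set if every vertex of $G$ has a neighbor in $D$; $\gamma_t(G)$ is the minimum cardinality of a total dominating set. -}

module Defs where

open import Data.Bool using (Bool; true; false)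
open import Data.Nat using (ℕ; _+_; _*_; _≤_; _/_)
open import Data.Integer as ℤ using (ℤ; +_)
open import Data.Fin using (Fin)
open import Data.Fin.Subset using (Subset; _∈_; _∩_; ∣_∣; Nonempty)
open import Data.Vec using (tabulate)
open import Data.Product using (Σ; _×_)
open import Relation.Binary.PropositionalEquality using (_≡_)
open import Relation.Nullary using (¬_)

record Graph (n : ℕ) : Set where
  field
    adj   : Fin n → Fin n → Bool
    sym   : ∀ u v → adj u v ≡ adj v u
    irrefl : ∀ v → adj v v ≡ false
open Graph public

N : ∀ {n} → Graph n → Fin n → Subset n
N G v = tabulate (adj G v)

deg : ∀ {n} → Graph n → Fin n → ℕ
deg G v = ∣ N G v ∣

degIn : ∀ {n} → Graph n → Subset n → Fin n → ℕ
degIn G X v = ∣ N G v ∩ X ∣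

Regular : ∀ {n} → Graph n → ℕ → Set
Regular G r = ∀ v → deg G v ≡ r

ceilHalf : ℕ → ℕ
ceilHalf r = (r + 1) / 2

-- M is a k-monopoly: nonempty and δ_M(v) ≥ δ(v)/2 + k for every v
-- (stated after multiplying by 2, in ℤ, since k may be negative).
IsMonopoly : ∀ {n} → Graph n → ℤ → Subset n → Set
IsMonopoly G k M =
  Nonempty M × (∀ v → (+ deg G v) ℤ.+ ((+ 2) ℤ.* k) ℤ.≤ + (2 * degIn G M v))

IsTDS : ∀ {n} → Graph n → Subset n → Set
IsTDS G D = ∀ v → Nonempty (N G v ∩ D)

IsMinCard : ∀ {n} → (Subset n → Set) → ℕ → Set
IsMinCard P m = Σ _ (λ S → P S × ∣ S ∣ ≡ m) × (∀ S → P S → m ≤ ∣ S ∣)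

IsMk : ∀ {n} → Graph n → ℤ → ℕ → Set
IsMk G k = IsMinCard (IsMonopoly G k)

IsGammaT : ∀ {n} → Graph n → ℕ → Set
IsGammaT G = IsMinCard (IsTDS G)

-- With k = 1 − ⌈r/2⌉ the k-monopoly inequality at a vertex v of an r-regular
-- graph reads 2 δ_M(v) ≥ r + 2 − 2⌈r/2⌉ ∈ {1, 2}, that is δ_M(v) ≥ 1.  Hence the
-- k-monopolies are exactly the total dominating sets (which are nonempty once G
-- has a vertex), and a minimum exists because V(G) totally dominates when r ≥ 1.
module Submission where

open import Defs
open import Data.Nat using (ℕ; _≤_)
open import Data.Integer using (+_; _-_)
open import Data.Product using (Σ; _×_)

open import Data.Nat as ℕ using (zero; suc; s≤s; z≤n; _<?_)
import Data.Nat.Properties as ℕ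
open import Data.Nat.DivMod using (m/n≡1+[m∸n]/n)
open import Data.Integer as ℤ using (ℤ)
import Data.Integer.Properties as ℤ
open import Data.Integer.Tactic.RingSolver using (solve-∀)
open import Data.Product using (_,_; proj₁; proj₂)
open import Data.Fin using (Fin; fromℕ<)
open import Data.Fin.Subset using (Subset; _∩_; ∣_∣; Nonempty; ⊤)
open import Data.Fin.Subset.Properties
  using (nonempty?; Empty-unique; ∣⊥∣≡0; ∣p∣≤n; x∈p⇒∣p-x∣<∣p∣; x∈p∩q⁺; x∈p∩q⁻; ∈⊤; anySubset?)
open import Data.Fin.Properties using (all?)
open import Function using (_⇔_; mk⇔; Equivalence)
import Function.Properties.Equivalence as ⇔
open import Relation.Nullary using (Dec; yes; no)
open import Relation.Nullary.Decidable using (_×-dec_)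
import Relation.Binary.PropositionalEquality as ≡
open ≡ using (_≡_; refl; cong; subst; module ≡-Reasoning)

open Equivalence using (to; from)

Nonempty⇒∣p∣≥1 : ∀ {n} {p : Subset n} → Nonempty p → 1 ≤ ∣ p ∣
Nonempty⇒∣p∣≥1 (_ , x∈p) = ℕ.≤-trans (s≤s z≤n) (x∈p⇒∣p-x∣<∣p∣ x∈p)

∣p∣≥1⇒Nonempty : ∀ {n} {p : Subset n} → 1 ≤ ∣ p ∣ → Nonempty p
∣p∣≥1⇒Nonempty {n} {p} 1≤∣p∣ with nonempty? p
... | yes ne = ne
... | no ¬ne with () ← subst (1 ≤_) (∣⊥∣≡0 n) (subst (λ q → 1 ≤ ∣ q ∣) (Empty-unique ¬ne) 1≤∣p∣)

module _ {n} {P : Subset n → Set} (P? : ∀ S → Dec (P S)) where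

  private
    -- Descend through P-sets of strictly decreasing size; the fuel k ≥ ∣ S ∣ makes this structural.
    descend : ∀ k S → ∣ S ∣ ≤ k → P S → Σ ℕ (IsMinCard P)
    descend k S ∣S∣≤k pS with anySubset? (λ T → P? T ×-dec (∣ T ∣ <? ∣ S ∣))
    ... | no ∄smaller = ∣ S ∣ , (S , pS , refl) , λ T pT → ℕ.≮⇒≥ (λ ∣T∣<∣S∣ → ∄smaller (T , pT , ∣T∣<∣S∣))
    descend zero    S ∣S∣≤0   pS | yes (T , pT , ∣T∣<∣S∣) with () ← ℕ.<-≤-trans ∣T∣<∣S∣ ∣S∣≤0
    descend (suc k) S ∣S∣≤1+k pS | yes (T , pT , ∣T∣<∣S∣) =
      descend k T (ℕ.≤-pred (ℕ.<-≤-trans ∣T∣<∣S∣ ∣S∣≤1+k)) pT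

  ∃-IsMinCard : ∀ {S} → P S → Σ ℕ (IsMinCard P)
  ∃-IsMinCard {S} = descend n S (∣p∣≤n S)

IsMinCard-cong : ∀ {n} {P Q : Subset n → Set} → (∀ S → P S ⇔ Q S) → ∀ {m} → IsMinCard P m → IsMinCard Q m
IsMinCard-cong P⇔Q ((S , pS , ∣S∣≡m) , minimal) =
  (S , to (P⇔Q S) pS , ∣S∣≡m) , λ T qT → minimal T (from (P⇔Q T) qT)

-- The left-hand side r + 2k of the doubled monopoly inequality of an r-regular graph, for k = 1 − ⌈r/2⌉.
slack : ℕ → ℤ
slack r = + r ℤ.+ (+ 2) ℤ.* (+ 1 - + ceilHalf r)

ceilHalf-+2 : ∀ r → ceilHalf (2 ℕ.+ r) ≡ suc (ceilHalf r)
ceilHalf-+2 r = m/n≡1+[m∸n]/n {2 ℕ.+ r ℕ.+ 1} {2} (s≤s (s≤s z≤n))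

slack-+2 : ∀ r → slack (2 ℕ.+ r) ≡ slack r
slack-+2 r = begin
  slack (2 ℕ.+ r)
    ≡⟨ cong (λ c → + (2 ℕ.+ r) ℤ.+ (+ 2) ℤ.* (+ 1 - + c)) (ceilHalf-+2 r) ⟩
  (+ 2 ℤ.+ + r) ℤ.+ (+ 2) ℤ.* (+ 1 - (+ 1 ℤ.+ + ceilHalf r))
    ≡⟨ cancel (+ r) (+ ceilHalf r) ⟩
  slack r
    ∎
  where
  open ≡-Reasoning
  cancel : ∀ x c → (+ 2 ℤ.+ x) ℤ.+ (+ 2) ℤ.* (+ 1 - (+ 1 ℤ.+ c)) ≡ x ℤ.+ (+ 2) ℤ.* (+ 1 - c)
  cancel = solve-∀

slack-bounds : ∀ r → + 1 ℤ.≤ slack r × slack r ℤ.≤ + 2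
slack-bounds 0             = ℤ.+≤+ (s≤s z≤n) , ℤ.≤-refl
slack-bounds 1             = ℤ.≤-refl , ℤ.+≤+ (s≤s z≤n)
slack-bounds (suc (suc r)) rewrite slack-+2 r = slack-bounds r

s≤2*d⇔1≤d : ∀ {s} → + 1 ℤ.≤ s → s ℤ.≤ + 2 → ∀ d → s ℤ.≤ + (2 ℕ.* d) ⇔ 1 ≤ d
s≤2*d⇔1≤d {s} 1≤s s≤2 d = mk⇔ (positive d) (bounded d)
  where
  positive : ∀ d → s ℤ.≤ + (2 ℕ.* d) → 1 ≤ d
  positive zero    s≤0 with () ← ℤ.drop‿+≤+ (ℤ.≤-trans 1≤s s≤0)
  positive (suc d) _   = s≤s z≤n
  bounded : ∀ d → 1 ≤ d → s ℤ.≤ + (2 ℕ.* d)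
  bounded d 1≤d = ℤ.≤-trans s≤2 (ℤ.+≤+ (ℕ.*-monoʳ-≤ 2 1≤d))

module _ {n} (G : Graph n) where

  IsTDS⇒Nonempty : Fin n → ∀ {D} → IsTDS G D → Nonempty D
  IsTDS⇒Nonempty v {D} tds with tds v
  ... | x , x∈N∩D = x , proj₂ (x∈p∩q⁻ (N G v) D x∈N∩D)

  ⊤-IsTDS : (∀ v → 1 ≤ deg G v) → IsTDS G ⊤
  ⊤-IsTDS 1≤deg v with ∣p∣≥1⇒Nonempty (1≤deg v)
  ... | x , x∈N = x , x∈p∩q⁺ (x∈N , ∈⊤)

  IsTDS? : ∀ D → Dec (IsTDS G D)
  IsTDS? D = all? (λ v → nonempty? (N G v ∩ D))

  module _ {r} (reg : Regular G r) where

    monopoly-at⇔dominated : ∀ M v →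
      + deg G v ℤ.+ (+ 2) ℤ.* (+ 1 - + ceilHalf r) ℤ.≤ + (2 ℕ.* degIn G M v) ⇔ Nonempty (N G v ∩ M)
    monopoly-at⇔dominated M v rewrite reg v = mk⇔
      (λ ineq → ∣p∣≥1⇒Nonempty (to bound ineq))
      (λ ne → from bound (Nonempty⇒∣p∣≥1 ne))
      where
      bound : slack r ℤ.≤ + (2 ℕ.* degIn G M v) ⇔ 1 ≤ degIn G M v
      bound = s≤2*d⇔1≤d (proj₁ (slack-bounds r)) (proj₂ (slack-bounds r)) (degIn G M v)

    IsMonopoly⇔IsTDS : Fin n → ∀ M → IsMonopoly G (+ 1 - + ceilHalf r) M ⇔ IsTDS G M
    IsMonopoly⇔IsTDS v M = mk⇔
      (λ (_ , ineq) w → to (monopoly-at⇔dominated M w) (ineq w))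
      (λ tds → IsTDS⇒Nonempty v tds , λ w → from (monopoly-at⇔dominated M w) (tds w))

theorem5 : ∀ {n} (G : Graph n) (r : ℕ) → 1 ≤ n → 1 ≤ r → Regular G r →
    Σ ℕ (λ m → IsMk G (+ 1 - + ceilHalf r) m × IsGammaT G m)
theorem5 G r 1≤n 1≤r reg =
  let m , γt = ∃-IsMinCard (IsTDS? G) (⊤-IsTDS G (λ v → subst (1 ≤_) (≡.sym (reg v)) 1≤r))
  in  m , IsMinCard-cong (λ M → ⇔.sym (IsMonopoly⇔IsTDS G reg (fromℕ< 1≤n) M)) γt , γt
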